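{- Let $\mathcal{F}$ be the labelled calculus with the rules $(id),(\bot_l),(\wedge_l),(\wedge_r),(\vee_l),(\vee_r),(\supset_r),(\supset_l),(tra),(id^*),(\supset^*_l),(lift)$ (i.e. $\mathsf{G3Int}+\{(id^*),(\supset^*_l),(lift)\}-(ref)$). Then $(tra)$ is eliminable in $\mathcal{F}$: every labelled sequent derivable in $\mathcal{F}$ is derivable in $\mathcal{F}$ without any application of $(tra)$.
   Context: Propositional formulas: $A ::= p \mid \bot \mid (A\vee A)\mid (A\wedge A)\mid (A\supset A)$. Labelled sequents $\mathcal{R},\Gamma\Rightarrow\Delta$: $\mathcal{R}$ a multiset of relational atoms $w\le v$, $\Gamma,\Delta$ multisets of labelled formulas $w:A$; components may be empty. Rules: $(id)$: $\mathcal{R},w\le v,w:p,\Gamma\Rightarrow\Delta,v:p$; $(\bot_l)$: $\mathcal{R},w:\bot,\Gamma\Rightarrow\Delta$; $(\wedge_l)$: from $\mathcal{R},w:A,w:B,\Gamma\Rightarrow\Delta$ infer $\mathcal{R},w:A\wedge B,\Gamma\Rightarrow\Delta$; $(\wedge_r)$: from $\mathcal{R},\Gamma\Rightarrow\Delta,w:A$ and $\mathcal{R},\Gamma\Rightarrow\Delta,w:B$ infer $\mathcal{R},\Gamma\Rightarrow\Delta,w:A\wedge B$; $(\vee_l)$: from $\mathcal{R},w:A,\Gamma\Rightarrow\Delta$ and $\mathcal{R},w:B,\Gamma\Rightarrow\Delta$ infer $\mathcal{R},w:A\vee B,\Gamma\Rightarrow\Delta$; $(\vee_r)$: from $\mathcal{R},\Gamma\Rightarrow\Delta,w:A,w:B$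 infer $\mathcal{R},\Gamma\Rightarrow\Delta,w:A\vee B$; $(\supset_r)$: from $\mathcal{R},w\le v,v:A,\Gamma\Rightarrow\Delta,v:B$ infer $\mathcal{R},\Gamma\Rightarrow\Delta,w:A\supset B$, provided $v$ does not occur in the conclusion; $(\supset_l)$: from $\mathcal{R},w\le v,w:A\supset B,\Gamma\Rightarrow\Delta,v:A$ and $\mathcal{R},w\le v,w:A\supset B,v:B,\Gamma\Rightarrow\Delta$ infer $\mathcal{R},w\le v,w:A\supset B,\Gamma\Rightarrow\Delta$; $(tra)$: from $\mathcal{R},w\le v,v\le u,w\le u,\Gamma\Rightarrow\Delta$ infer $\mathcal{R},w\le v,v\le u,\Gamma\Rightarrow\Delta$; $(id^*)$: $\mathcal{R},w:p,\Gamma\Rightarrow\Delta,w:p$; $(\supset^*_l)$: from $\mathcal{R},w:A\supset B,\Gamma\Rightarrow\Delta,w:A$ and $\mathcal{R},w:A\supset B,w:B,\Gamma\Rightarrow\Delta$ infer $\mathcal{R},w:A\supset B,\Gamma\Rightarrow\Delta$; $(lift)$: from $\mathcal{R},w\le u,w:A,u:A,\Gamma\Rightarrow\Delta$ infer $\mathcal{R},w\le u,w:A,\Gamma\Rightarrow\Delta$. -}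

module Defs where

open import Data.Nat using (ℕ)
open import Data.Bool using (Bool; true; false)
open import Data.Product using (_×_; _,_)
open import Data.List using (List; []; _∷_; _++_; map; concatMap)
open import Data.List.Membership.Propositional using (_∈_)
open import Data.List.Relation.Binary.Permutation.Propositional using (_↭_)
open import Relation.Nullary using (¬_)

data Fm : Set where
  atom : ℕ → Fm
  ⊥'   : Fm
  _∨'_ : Fm → Fm → Fm
  _∧'_ : Fm → Fm → Fm
  _⊃_  : Fm → Fm → Fm

Label : Set
Label = ℕ

-- relational atom w ≤ v
RelAtom : Set
RelAtom = Label × Label

LFm : Set
LFm = Label × Fm

-- labelled sequent R , Γ ⇒ Δ ; multisets represented by lists,
-- with an exchange rule (permutation in each component) making order irrelevant
record Seq : Set where
  constructor _∣_⇒_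
  field
    rel : List RelAtom
    ant : List LFm
    suc : List LFm

labelsR : List RelAtom → List Label
labelsR = concatMap (λ { (w , v) → w ∷ v ∷ [] })

labelsF : List LFm → List Label
labelsF = map (λ { (w , _) → w })

Occurs : Label → Seq → Set
Occurs v (R ∣ Γ ⇒ Δ) = v ∈ (labelsR R ++ labelsF Γ ++ labelsF Δ)

-- Derivability in F. The Bool index says whether (tra) may be used:
-- Der true S  : S derivable in F
-- Der false S : S derivable in F without any application of (tra)
data Der : Bool → Seq → Set where
  exch : ∀ {t R R' Γ Γ' Δ Δ'} → R ↭ R' → Γ ↭ Γ' → Δ ↭ Δ' →
         Der t (R ∣ Γ ⇒ Δ) → Der t (R' ∣ Γ' ⇒ Δ')
  idr  : ∀ {t R Γ Δ w v p} →
         Der t (((w , v) ∷ R) ∣ ((w , atom p) ∷ Γ) ⇒ ((v , atom p) ∷ Δ))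
  ⊥l   : ∀ {t R Γ Δ w} → Der t (R ∣ ((w , ⊥') ∷ Γ) ⇒ Δ)
  ∧l   : ∀ {t R Γ Δ w A B} →
         Der t (R ∣ ((w , A) ∷ (w , B) ∷ Γ) ⇒ Δ) →
         Der t (R ∣ ((w , A ∧' B) ∷ Γ) ⇒ Δ)
  ∧r   : ∀ {t R Γ Δ w A B} →
         Der t (R ∣ Γ ⇒ ((w , A) ∷ Δ)) →
         Der t (R ∣ Γ ⇒ ((w , B) ∷ Δ)) →
         Der t (R ∣ Γ ⇒ ((w , A ∧' B) ∷ Δ))
  ∨l   : ∀ {t R Γ Δ w A B} →
         Der t (R ∣ ((w , A) ∷ Γ) ⇒ Δ) →
         Der t (R ∣ ((w , B) ∷ Γ) ⇒ Δ) →
         Der t (R ∣ ((w , A ∨' B) ∷ Γ) ⇒ Δ)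
  ∨r   : ∀ {t R Γ Δ w A B} →
         Der t (R ∣ Γ ⇒ ((w , A) ∷ (w , B) ∷ Δ)) →
         Der t (R ∣ Γ ⇒ ((w , A ∨' B) ∷ Δ))
  ⊃r   : ∀ {t R Γ Δ w v A B} →
         ¬ Occurs v (R ∣ Γ ⇒ ((w , A ⊃ B) ∷ Δ)) →
         Der t (((w , v) ∷ R) ∣ ((v , A) ∷ Γ) ⇒ ((v , B) ∷ Δ)) →
         Der t (R ∣ Γ ⇒ ((w , A ⊃ B) ∷ Δ))
  ⊃l   : ∀ {t R Γ Δ w v A B} →
         Der t (((w , v) ∷ R) ∣ ((w , A ⊃ B) ∷ Γ) ⇒ ((v , A) ∷ Δ)) →
         Der t (((w , v) ∷ R) ∣ ((w , A ⊃ B) ∷ (v , B) ∷ Γ) ⇒ Δ) →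
         Der t (((w , v) ∷ R) ∣ ((w , A ⊃ B) ∷ Γ) ⇒ Δ)
  tra  : ∀ {R Γ Δ w v u} →
         Der true (((w , v) ∷ (v , u) ∷ (w , u) ∷ R) ∣ Γ ⇒ Δ) →
         Der true (((w , v) ∷ (v , u) ∷ R) ∣ Γ ⇒ Δ)
  id*  : ∀ {t R Γ Δ w p} →
         Der t (R ∣ ((w , atom p) ∷ Γ) ⇒ ((w , atom p) ∷ Δ))
  ⊃l*  : ∀ {t R Γ Δ w A B} →
         Der t (R ∣ ((w , A ⊃ B) ∷ Γ) ⇒ ((w , A) ∷ Δ)) →
         Der t (R ∣ ((w , A ⊃ B) ∷ (w , B) ∷ Γ) ⇒ Δ) →
         Der t (R ∣ ((w , A ⊃ B) ∷ Γ) ⇒ Δ)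
  lift : ∀ {t R Γ Δ w u A} →
         Der t (((w , u) ∷ R) ∣ ((w , A) ∷ (u , A) ∷ Γ) ⇒ Δ) →
         Der t (((w , u) ∷ R) ∣ ((w , A) ∷ Γ) ⇒ Δ)

-- An application of (tra) adds w ≤ u to a sequent that already contains w ≤ v
-- and v ≤ u. In a (tra)-free derivation the atom w ≤ u is principal only in
-- (id), (⊃l) and (lift); each such use is simulated by lifting the formula at w
-- along w ≤ v and v ≤ u and closing with (id*) or (⊃l*) at u, or by keeping the
-- lifted copy at u. Lifting along v needs weakening by v : A, which is
-- admissible because v already occurs in the relational part, so it cannot
-- clash with an eigenvariable. Hence w ≤ u can be dropped, and the (tra)
-- applications are removed one by one from the top of the derivation down.
module Submission where

open import Defs
open import Data.Bool using (true; false)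
open import Data.Product using (∃; _×_; _,_)
open import Data.Sum using (_⊎_; inj₁; inj₂)
open import Data.List using (List; []; _∷_; _++_)
open import Data.List.Relation.Unary.Any using (here; there)
open import Data.List.Membership.Propositional using (_∈_)
open import Data.List.Membership.Propositional.Properties using (∈-∃++; ∈-++⁺ˡ)
open import Data.List.Relation.Binary.Permutation.Propositional
open import Data.List.Relation.Binary.Permutation.Propositional.Properties
  using (∈-resp-↭; drop-∷; shift; ++⁺ʳ; shifts)
open import Relation.Binary.PropositionalEquality using (_≡_; refl)
open import Relation.Nullary using (¬_)

private
  variable
    X : Set
    a b c x y : X
    xs ys : List X

↭-swap₁ : a ∷ b ∷ xs ↭ b ∷ a ∷ xs
↭-swap₁ = swap _ _ refl

↭-rotate₃ : a ∷ b ∷ c ∷ xs ↭ b ∷ c ∷ a ∷ xs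
↭-rotate₃ = trans ↭-swap₁ (prep _ ↭-swap₁)

∈⇒↭-∷ : x ∈ xs → ∃ λ ys → xs ↭ x ∷ ys
∈⇒↭-∷ x∈xs with ys , zs , refl ← ∈-∃++ x∈xs = ys ++ zs , shift _ ys zs

↭-∷-inv : x ∷ xs ↭ y ∷ ys →
          (x ≡ y × xs ↭ ys) ⊎ ∃ λ zs → ys ↭ x ∷ zs × xs ↭ y ∷ zs
↭-∷-inv ρ with ∈-resp-↭ ρ (here refl)
... | here refl = inj₁ (refl , drop-∷ ρ)
... | there x∈ys with zs , ys↭ ← ∈⇒↭-∷ x∈ys =
  inj₂ (zs , ys↭ , drop-∷ (trans ρ (trans (prep _ ys↭) ↭-swap₁)))

labelsR-↭ : ∀ {R R′} → R ↭ R′ → labelsR R ↭ labelsR R′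
labelsR-↭ refl                       = refl
labelsR-↭ (prep (w , v) ρ)           = prep w (prep v (labelsR-↭ ρ))
labelsR-↭ (swap (w , v) (w′ , v′) ρ) =
  trans (shifts (w ∷ v ∷ []) (w′ ∷ v′ ∷ []))
        (prep w′ (prep v′ (prep w (prep v (labelsR-↭ ρ)))))
labelsR-↭ (trans ρ σ)                = trans (labelsR-↭ ρ) (labelsR-↭ σ)

∈-labelsR⁺ʳ : ∀ {w v R} → (w , v) ∈ R → v ∈ labelsR R
∈-labelsR⁺ʳ (here refl)             = there (here refl)
∈-labelsR⁺ʳ {R = _ ∷ _} (there wv) = there (there (∈-labelsR⁺ʳ wv))

¬Occurs-weaken : ∀ {R Γ Δ x A v} → x ∈ labelsR R →
                 ¬ Occurs v (R ∣ Γ ⇒ Δ) → ¬ Occurs v (R ∣ (x , A) ∷ Γ ⇒ Δ)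
¬Occurs-weaken {R = R} x∈R fresh occ with ∈-resp-↭ (shift _ (labelsR R) _) occ
... | here refl  = fresh (∈-++⁺ˡ x∈R)
... | there occ′ = fresh occ′

¬Occurs-drop : ∀ {R₀ Γ Δ R p v} → R ↭ p ∷ R₀ →
               ¬ Occurs v (R ∣ Γ ⇒ Δ) → ¬ Occurs v (R₀ ∣ Γ ⇒ Δ)
¬Occurs-drop ρ fresh occ =
  fresh (∈-resp-↭ (++⁺ʳ _ (labelsR-↭ (↭-sym ρ))) (there (there occ)))

weaken : ∀ {R Γ Δ x A} → x ∈ labelsR R →
         Der false (R ∣ Γ ⇒ Δ) → Der false (R ∣ (x , A) ∷ Γ ⇒ Δ)
weaken x∈R (exch ρR ρΓ ρΔ d) =
  exch ρR (prep _ ρΓ) ρΔ (weaken (∈-resp-↭ (labelsR-↭ (↭-sym ρR)) x∈R) d)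
weaken x∈R idr        = exch refl ↭-swap₁ refl idr
weaken x∈R ⊥l         = exch refl ↭-swap₁ refl ⊥l
weaken x∈R (∧l d)     = exch refl ↭-swap₁ refl (∧l (exch refl ↭-rotate₃ refl (weaken x∈R d)))
weaken x∈R (∧r d e)   = ∧r (weaken x∈R d) (weaken x∈R e)
weaken x∈R (∨l d e)   =
  exch refl ↭-swap₁ refl
    (∨l (exch refl ↭-swap₁ refl (weaken x∈R d)) (exch refl ↭-swap₁ refl (weaken x∈R e)))
weaken x∈R (∨r d)     = ∨r (weaken x∈R d)
weaken {R} {Γ} {A = C} x∈R (⊃r {Δ = Δ} {w} {A = A} {B} fresh d) =
  ⊃r (¬Occurs-weaken {R} {Γ} {(w , A ⊃ B) ∷ Δ} {A = C} x∈R fresh)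
     (exch refl ↭-swap₁ refl (weaken (there (there x∈R)) d))
weaken x∈R (⊃l d e)   =
  exch refl ↭-swap₁ refl
    (⊃l (exch refl ↭-swap₁ refl (weaken x∈R d)) (exch refl ↭-rotate₃ refl (weaken x∈R e)))
weaken x∈R id*        = exch refl ↭-swap₁ refl id*
weaken x∈R (⊃l* d e)  =
  exch refl ↭-swap₁ refl
    (⊃l* (exch refl ↭-swap₁ refl (weaken x∈R d)) (exch refl ↭-rotate₃ refl (weaken x∈R e)))
weaken x∈R (lift d)   = exch refl ↭-swap₁ refl (lift (exch refl ↭-rotate₃ refl (weaken x∈R d)))

lift-∈ : ∀ {R Γ Δ w u A} → (w , u) ∈ R →
         Der false (R ∣ (w , A) ∷ (u , A) ∷ Γ ⇒ Δ) → Der false (R ∣ (w , A) ∷ Γ ⇒ Δ)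
lift-∈ wu d with _ , ρ ← ∈⇒↭-∷ wu = exch (↭-sym ρ) refl refl (lift (exch ρ refl refl d))

lift-path : ∀ {R Γ Δ w v u A} → (w , v) ∈ R → (v , u) ∈ R →
            Der false (R ∣ (u , A) ∷ (w , A) ∷ Γ ⇒ Δ) → Der false (R ∣ (w , A) ∷ Γ ⇒ Δ)
lift-path wv vu d =
  lift-∈ wv (exch refl ↭-swap₁ refl (lift-∈ vu (weaken (∈-labelsR⁺ʳ wv) d)))

tra-admissible : ∀ {R R₀ Γ Δ w v u} → R ↭ (w , u) ∷ R₀ → (w , v) ∈ R₀ → (v , u) ∈ R₀ →
                 Der false (R ∣ Γ ⇒ Δ) → Der false (R₀ ∣ Γ ⇒ Δ)
tra-admissible ρ wv vu (exch ρR ρΓ ρΔ d) =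
  exch refl ρΓ ρΔ (tra-admissible (trans ρR ρ) wv vu d)
tra-admissible ρ wv vu ⊥l         = ⊥l
tra-admissible ρ wv vu (∧l d)     = ∧l (tra-admissible ρ wv vu d)
tra-admissible ρ wv vu (∧r d e)   = ∧r (tra-admissible ρ wv vu d) (tra-admissible ρ wv vu e)
tra-admissible ρ wv vu (∨l d e)   = ∨l (tra-admissible ρ wv vu d) (tra-admissible ρ wv vu e)
tra-admissible ρ wv vu (∨r d)     = ∨r (tra-admissible ρ wv vu d)
tra-admissible {R₀ = R₀} {Γ} ρ wv vu (⊃r {Δ = Δ} {w} {A = A} {B} fresh d) =
  ⊃r (¬Occurs-drop {R₀} {Γ} {(w , A ⊃ B) ∷ Δ} ρ fresh)
     (tra-admissible (trans (prep _ ρ) ↭-swap₁) (there wv) (there vu) d)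
tra-admissible ρ wv vu id*        = id*
tra-admissible ρ wv vu (⊃l* d e)  = ⊃l* (tra-admissible ρ wv vu d) (tra-admissible ρ wv vu e)
tra-admissible ρ wv vu idr with ↭-∷-inv ρ
... | inj₁ (refl , _)   = lift-path wv vu id*
... | inj₂ (_ , ρ₀ , _) = exch (↭-sym ρ₀) refl refl idr
tra-admissible ρ wv vu (⊃l d e) with ↭-∷-inv ρ
... | inj₁ (refl , ρ₁) =
  lift-path wv vu
    (⊃l* (weaken (∈-labelsR⁺ʳ vu) (tra-admissible (prep _ ρ₁) wv vu d))
         (exch refl (prep _ ↭-swap₁) refl
           (weaken (∈-labelsR⁺ʳ vu) (tra-admissible (prep _ ρ₁) wv vu e))))
... | inj₂ (_ , ρ₀ , ρ₁) =
  exch (↭-sym ρ₀) refl refl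
    (⊃l (tra-admissible (trans (prep _ ρ₁) ↭-swap₁) (∈-resp-↭ ρ₀ wv) (∈-resp-↭ ρ₀ vu) d)
        (tra-admissible (trans (prep _ ρ₁) ↭-swap₁) (∈-resp-↭ ρ₀ wv) (∈-resp-↭ ρ₀ vu) e))
tra-admissible ρ wv vu (lift d) with ↭-∷-inv ρ
... | inj₁ (refl , ρ₁) =
  lift-path wv vu (exch refl ↭-swap₁ refl (tra-admissible (prep _ ρ₁) wv vu d))
... | inj₂ (_ , ρ₀ , ρ₁) =
  exch (↭-sym ρ₀) refl refl
    (lift (tra-admissible (trans (prep _ ρ₁) ↭-swap₁) (∈-resp-↭ ρ₀ wv) (∈-resp-↭ ρ₀ vu) d))

lemma5 : (S : Seq) → Der true S → Der false S
lemma5 _ (exch ρR ρΓ ρΔ d) = exch ρR ρΓ ρΔ (lemma5 _ d)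
lemma5 _ idr       = idr
lemma5 _ ⊥l        = ⊥l
lemma5 _ (∧l d)    = ∧l (lemma5 _ d)
lemma5 _ (∧r d e)  = ∧r (lemma5 _ d) (lemma5 _ e)
lemma5 _ (∨l d e)  = ∨l (lemma5 _ d) (lemma5 _ e)
lemma5 _ (∨r d)    = ∨r (lemma5 _ d)
lemma5 _ (⊃r f d)  = ⊃r f (lemma5 _ d)
lemma5 _ (⊃l d e)  = ⊃l (lemma5 _ d) (lemma5 _ e)
lemma5 _ (tra d)   =
  tra-admissible (trans (prep _ ↭-swap₁) ↭-swap₁) (here refl) (there (here refl)) (lemma5 _ d)
lemma5 _ id*       = id*
lemma5 _ (⊃l* d e) = ⊃l* (lemma5 _ d) (lemma5 _ e)
lemma5 _ (lift d)  = lift (lemma5 _ d)
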